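{- Let $m,k,n$ be positive integers. The property $P(m,k,n,1)$ fails if and only if $m<kn-k+1$.
   Context: A tree is a nonempty set of finite sequences of natural numbers closed under initial segments, ordered by the initial-segment relation; $\mu(T)$ is the set of maximal elements of $T$. $T$ is $i$-branching if every $\sigma\in T\setminus\mu(T)$ has exactly $i$ immediate successors in $T$. A subtree of $T$ is a subset of $T$ which is itself a tree. For integers $i,j,k,m$, $P(i,j,k,m)$ means: for every finite $i$-branching tree $T$ and every colouring $\chi:\mu(T)\to\{0,\dots,j-1\}$ there is a $k$-branching subtree $T'\subseteq T$ with $\mu(T')\subseteq\mu(T)$ such that $\chi\restriction\mu(T')$ takes at most $m$ values. -}

module Defs where

open import Data.Nat using (ℕ; _≤_)
open import Data.Fin using (Fin)
open import Data.List using (List; []; _∷_; _++_; [_]; length)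
open import Data.List.Membership.Propositional using (_∈_)
open import Data.List.Relation.Unary.Unique.Propositional using (Unique)
open import Data.Product using (Σ; ∃; ∃-syntax; _×_)
open import Relation.Binary.PropositionalEquality using (_≡_; _≢_)
open import Relation.Nullary using (¬_)
open import Function.Bundles using (_⇔_)

Seq : Set
Seq = List ℕ

-- a FINITE set of sequences, represented by a list enumerating its elements
FinSet : Set
FinSet = List Seq

_≼_ : Seq → Seq → Set
τ ≼ σ = ∃[ ρ ] (τ ++ ρ ≡ σ)

_≺_ : Seq → Seq → Set
τ ≺ σ = ∃[ ρ ] (ρ ≢ [] × τ ++ ρ ≡ σ)

IsTree : FinSet → Set
IsTree T = (∃[ σ ] σ ∈ T) × (∀ σ τ → σ ∈ T → τ ≼ σ → τ ∈ T)

Maximal : FinSet → Seq → Set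
Maximal T σ = σ ∈ T × (∀ τ → τ ∈ T → ¬ (σ ≺ τ))

ExactlySucc : ℕ → FinSet → Seq → Set
ExactlySucc i T σ =
  ∃[ ns ] (Unique ns × length ns ≡ i × (∀ n → ((σ ++ [ n ]) ∈ T ⇔ n ∈ ns)))

Branching : ℕ → FinSet → Set
Branching i T = ∀ σ → σ ∈ T → ¬ Maximal T σ → ExactlySucc i T σ

_⊆ₛ_ : FinSet → FinSet → Set
A ⊆ₛ B = ∀ σ → σ ∈ A → σ ∈ B

MaxSub : FinSet → FinSet → Set
MaxSub T' T = ∀ σ → Maximal T' σ → Maximal T σ

AtMostValues : ∀ {j} → ℕ → (Seq → Fin j) → FinSet → Set
AtMostValues {j} m χ T' =
  ∃[ cs ] (length cs ≤ m × (∀ σ → Maximal T' σ → χ σ ∈ cs))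

P : ℕ → ℕ → ℕ → ℕ → Set
P i j k m =
  ∀ (T : FinSet) → IsTree T → Branching i T → (χ : Seq → Fin j) →
  ∃[ T' ] (IsTree T' × T' ⊆ₛ T × Branching k T' × MaxSub T' T × AtMostValues m χ T')

-- Write the required branching as n + 1, so that the threshold becomes k * n + 1.
-- If k * n < m, monochromatic (n+1)-branching subtrees can be built bottom-up: a leaf is one on
-- its own, and at an inner node the m children carry such subtrees in k colours, so by
-- pigeonhole n + 1 of them share a colour and can be grafted below the node. If m ≤ k * n,
-- colour the leaf x of the one-level m-branching tree by x mod k: the leaves below k * n with a
-- given residue are determined by their quotient by k, which is below n, so no colour occurs
-- n + 1 times at the root.
module Submission where

open import Defs
open import Data.Empty using (⊥)
open import Data.Fin using (Fin; toℕ)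
import Data.Fin as Fin
open import Data.Fin.Properties using (toℕ-fromℕ<)
open import Data.List
  using (List; []; _∷_; _++_; [_]; length; map; filter; take; drop; concatMap; allFin; upTo)
open import Data.List.Extrema.Nat using (max; xs≤max)
open import Data.List.Membership.Propositional using (_∈_; find; lose; mapWith∈)
open import Data.List.Membership.Propositional.Properties
  using (∈-map⁺; ∈-map⁻; ∈-concatMap⁺; ∈-concatMap⁻; ∈-allFin; ∈-upTo⁺; ∈-upTo⁻)
open import Data.List.Properties
  using ( ++-assoc; ++-identityʳ; length-++; length-map; length-take; length-tabulate; length-upTo
        ; take++drop≡id; take-take; ∷ʳ-injectiveʳ)
import Data.List.Properties as List
open import Data.List.Relation.Binary.Sublist.Propositional using (_⊆_)
import Data.List.Relation.Binary.Sublist.Propositional.Properties as Sublist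
open import Data.List.Relation.Unary.All as All using (All; []; _∷_)
import Data.List.Relation.Unary.All.Properties as All
open import Data.List.Relation.Unary.AllPairs using ([]; _∷_)
import Data.List.Relation.Unary.AllPairs.Properties as AllPairs
open import Data.List.Relation.Unary.Any using (here; there; any?)
open import Data.List.Relation.Unary.Unique.Propositional using (Unique)
import Data.List.Relation.Unary.Unique.Propositional.Properties as Unique
open import Data.Nat
  using (ℕ; zero; suc; _*_; _∸_; _+_; _⊓_; _<_; _≤_; z≤n; s≤s; z<s; _≟_; _<?_; NonZero; >-nonZero)
open import Data.Nat.DivMod using (_/_; _%_; _mod_; m%n<n; m≡m%n+[m/n]*n; m<n*o⇒m/o<n)
open import Data.Nat.Properties
open import Data.Product using (∃; ∃-syntax; _×_; _,_; proj₁; proj₂; uncurry)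
open import Data.Sum using (inj₁; inj₂)
open import Function using (id; _∘_)
open import Function.Bundles using (_⇔_; mk⇔; Equivalence)
open import Level using (0ℓ)
open import Relation.Binary.Definitions using (DecidableEquality; Decidable)
open import Relation.Binary.PropositionalEquality
  using (_≡_; refl; sym; trans; cong; cong₂; subst; subst₂; module ≡-Reasoning)
open import Relation.Nullary using (¬_; yes; no; contradiction)
open import Relation.Nullary.Decidable using (map′; _×-dec_)
open import Relation.Unary using (Pred)
import Relation.Unary as Unary
open import Relation.Unary.Properties using (∁?)

length-filter+length-filter-∁ : ∀ {A : Set} {P : Pred A 0ℓ} (P? : Unary.Decidable P) xs →
  length (filter P? xs) + length (filter (∁? P?) xs) ≡ length xs
length-filter+length-filter-∁ P? [] = refl
length-filter+length-filter-∁ P? (x ∷ xs) with P? x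
... | yes _ = cong suc (length-filter+length-filter-∁ P? xs)
... | no _  = trans (+-suc _ _) (cong suc (length-filter+length-filter-∁ P? xs))

length≡suc⇒∃∈ : ∀ {A : Set} {n} (xs : List A) → length xs ≡ suc n → ∃ (_∈ xs)
length≡suc⇒∃∈ (x ∷ _) _ = x , here refl

module _ {A C : Set} (_≟_ : DecidableEquality C) (f : A → C) where

  fibre : C → List A → List A
  fibre c = filter (λ a → f a ≟ c)

  pigeonhole : ∀ n cs xs → All (λ a → f a ∈ cs) xs → length cs * n < length xs →
               ∃[ c ] n < length (fibre c xs)
  pigeonhole n [] [] _ ()
  pigeonhole n [] (_ ∷ _) (() ∷ _) _
  pigeonhole n (c ∷ cs) xs fxs∈c∷cs c∷cs*n<xs with n <? length (fibre c xs)
  ... | yes n<fibre = c , n<fibre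
  ... | no n≮fibre =
    let c′ , n<fibre′ = pigeonhole n cs rest rest∈cs cs*n<rest
    in c′ , <-≤-trans n<fibre′ (Sublist.length-mono-≤ fibre-of-rest⊆fibre)
    where
    open ≤-Reasoning

    rest : List A
    rest = filter (∁? (λ a → f a ≟ c)) xs

    rest∈cs : All (λ a → f a ∈ cs) rest
    rest∈cs = All.zipWith (λ { (here fa≡c , fa≢c) → contradiction fa≡c fa≢c
                             ; (there fa∈cs , _)   → fa∈cs })
                          (All.filter⁺ _ fxs∈c∷cs , All.all-filter _ xs)

    cs*n<rest : length cs * n < length rest
    cs*n<rest = +-cancelˡ-< n _ _ (begin-strict
      n + length cs * n                 <⟨ c∷cs*n<xs ⟩
      length xs                         ≡⟨ sym (length-filter+length-filter-∁ _ xs) ⟩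
      length (fibre c xs) + length rest ≤⟨ +-monoˡ-≤ _ (≮⇒≥ n≮fibre) ⟩
      n + length rest                   ∎)

    fibre-of-rest⊆fibre : ∀ {c′} → fibre c′ rest ⊆ fibre c′ xs
    fibre-of-rest⊆fibre = Sublist.filter⁺ _ _ (λ { refl → id }) (Sublist.filter-⊆ _ xs)

Unique-map-injective : ∀ {A B : Set} {f : A → B} {xs : List A} {a b : A} →
  Unique (map f xs) → a ∈ xs → b ∈ xs → f a ≡ f b → a ≡ b
Unique-map-injective (_ ∷ _) (here refl) (here refl) _ = refl
Unique-map-injective (fa∉ ∷ _) (here refl) (there b∈xs) fa≡fb =
  contradiction fa≡fb (All.lookup fa∉ (∈-map⁺ _ b∈xs))
Unique-map-injective (fb∉ ∷ _) (there a∈xs) (here refl) fa≡fb =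
  contradiction (sym fa≡fb) (All.lookup fb∉ (∈-map⁺ _ a∈xs))
Unique-map-injective (_ ∷ unique) (there a∈xs) (there b∈xs) fa≡fb =
  Unique-map-injective unique a∈xs b∈xs fa≡fb

map-proj₁-mapWith∈ : ∀ {A : Set} {B : A → Set} (xs : List A) (f : ∀ {x} → x ∈ xs → B x) →
  map proj₁ (mapWith∈ xs (λ {x} x∈xs → x , f x∈xs)) ≡ xs
map-proj₁-mapWith∈ [] f = refl
map-proj₁-mapWith∈ (x ∷ xs) f = cong (x ∷_) (map-proj₁-mapWith∈ xs (f ∘ there))

at-most-one-value : ∀ {B : Set} (cs : List B) → length cs ≤ 1 → B → ∃[ c ] (∀ {b} → b ∈ cs → b ≡ c)
at-most-one-value [] _ b = b , λ ()
at-most-one-value (c ∷ []) _ _ = c , λ { (here refl) → refl }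
at-most-one-value (_ ∷ _ ∷ _) (s≤s ()) _

private variable
  σ τ υ : Seq
  x y : ℕ

≼-refl : σ ≼ σ
≼-refl {σ} = [] , ++-identityʳ σ

≼-trans : σ ≼ τ → τ ≼ υ → σ ≼ υ
≼-trans {σ} (ρ , refl) (ρ′ , refl) = ρ ++ ρ′ , sym (++-assoc σ ρ ρ′)

≼-length : σ ≼ τ → length σ ≤ length τ
≼-length {σ} (ρ , refl) = ≤-trans (m≤m+n (length σ) (length ρ)) (≤-reflexive (sym (length-++ σ)))

≼∧length≡⇒≡ : σ ≼ τ → length σ ≡ length τ → σ ≡ τ
≼∧length≡⇒≡ {σ} ([] , σ++[]≡τ) _ = trans (sym (++-identityʳ σ)) σ++[]≡τ
≼∧length≡⇒≡ {σ} (_ ∷ _ , refl) eq =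
  contradiction (trans eq (length-++ σ)) (<⇒≢ (m<m+n (length σ) z<s))

≼-antisym : σ ≼ τ → τ ≼ σ → σ ≡ τ
≼-antisym σ≼τ τ≼σ = ≼∧length≡⇒≡ σ≼τ (≤-antisym (≼-length σ≼τ) (≼-length τ≼σ))

≺⇒≼ : σ ≺ τ → σ ≼ τ
≺⇒≼ (ρ , _ , eq) = ρ , eq

≺-length : σ ≺ τ → length σ < length τ
≺-length ([] , ρ≢[] , _) = contradiction refl ρ≢[]
≺-length {σ} (_ ∷ _ , _ , refl) =
  <-≤-trans (m<m+n (length σ) z<s) (≤-reflexive (sym (length-++ σ)))

≼∧<⇒≺ : σ ≼ τ → length σ < length τ → σ ≺ τ
≼∧<⇒≺ {σ} ([] , σ++[]≡τ) σ<τ =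
  contradiction (cong length (trans (sym (++-identityʳ σ)) σ++[]≡τ)) (<⇒≢ σ<τ)
≼∧<⇒≺ (x ∷ ρ , eq) _ = x ∷ ρ , (λ ()) , eq

≺-irrefl : ¬ σ ≺ σ
≺-irrefl σ≺σ = <-irrefl refl (≺-length σ≺σ)

≼⇒take≡ : σ ≼ τ → take (length σ) τ ≡ σ
≼⇒take≡ {[]} _ = refl
≼⇒take≡ {x ∷ σ} (ρ , refl) = cong (x ∷_) (≼⇒take≡ (ρ , refl))

take≡⇒≼ : take (length σ) τ ≡ σ → σ ≼ τ
take≡⇒≼ {σ} {τ} eq =
  drop (length σ) τ , subst (λ υ → υ ++ drop (length σ) τ ≡ τ) eq (take++drop≡id (length σ) τ)

_≼?_ : Decidable _≼_
σ ≼? τ = map′ take≡⇒≼ ≼⇒take≡ (List.≡-dec _≟_ (take (length σ) τ) σ)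

_≺?_ : Decidable _≺_
σ ≺? τ = map′ (uncurry ≼∧<⇒≺) (λ σ≺τ → ≺⇒≼ σ≺τ , ≺-length σ≺τ)
              ((σ ≼? τ) ×-dec (length σ <? length τ))

≼-by-length : σ ≼ υ → τ ≼ υ → length σ ≤ length τ → σ ≼ τ
≼-by-length {σ} {υ} {τ} σ≼υ τ≼υ σ≤τ = take≡⇒≼ (begin
  take (length σ) τ                   ≡⟨ cong (take (length σ)) (sym (≼⇒take≡ τ≼υ)) ⟩
  take (length σ) (take (length τ) υ) ≡⟨ take-take (length σ) (length τ) υ ⟩
  take (length σ ⊓ length τ) υ        ≡⟨ cong (λ i → take i υ) (m≤n⇒m⊓n≡m σ≤τ) ⟩
  take (length σ) υ                   ≡⟨ ≼⇒take≡ σ≼υ ⟩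
  σ                                   ∎)
  where open ≡-Reasoning

length-∷ʳ : ∀ σ → length (σ ++ [ x ]) ≡ suc (length σ)
length-∷ʳ σ = trans (length-++ σ) (+-comm (length σ) 1)

∷ʳ-≼-injective : (σ ++ [ x ]) ≼ τ → (σ ++ [ y ]) ≼ τ → x ≡ y
∷ʳ-≼-injective {σ} σx≼τ σy≼τ =
  ∷ʳ-injectiveʳ σ σ (≼∧length≡⇒≡ (≼-by-length σx≼τ σy≼τ (≤-reflexive eq)) eq)
  where
  eq : length (σ ++ [ _ ]) ≡ length (σ ++ [ _ ])
  eq = trans (length-∷ʳ σ) (sym (length-∷ʳ σ))

∷ʳ-⋠ : ¬ (σ ++ [ x ]) ≼ σ
∷ʳ-⋠ {σ} σx≼σ = <-irrefl refl (subst (_≤ length σ) (length-∷ʳ σ) (≼-length σx≼σ))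

height : FinSet → ℕ
height T = max 0 (map length T)

length≤height : ∀ {T} → τ ∈ T → length τ ≤ height T
length≤height {T = T} τ∈T = All.lookup (All.map⁻ (xs≤max 0 (map length T))) τ∈T

module MonoSubtrees {k : ℕ} (T : FinSet) (n : ℕ) (χ : Seq → Fin k) where

  record IsMonoSubtree (σ : Seq) (c : Fin k) (S : FinSet) : Set where
    field
      root∈         : σ ∈ S
      above-root    : τ ∈ S → σ ≼ τ
      ⊆T            : S ⊆ₛ T
      closed        : ∀ {τ ρ} → τ ∈ S → σ ≼ ρ → ρ ≼ τ → ρ ∈ S
      branching     : Branching (suc n) S
      maximal       : MaxSub S T
      monochromatic : ∀ τ → Maximal S τ → χ τ ≡ c

  record MonoSubtree (σ : Seq) : Set where
    field
      colour        : Fin k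
      nodes         : FinSet
      isMonoSubtree : IsMonoSubtree σ colour nodes
    open IsMonoSubtree isMonoSubtree public

  open MonoSubtree

  leaf : Maximal T σ → MonoSubtree σ
  leaf {σ} σ-max = record
    { colour = χ σ
    ; nodes = [ σ ]
    ; isMonoSubtree = record
      { root∈ = here refl
      ; above-root = λ { (here refl) → ≼-refl }
      ; ⊆T = λ { _ (here refl) → proj₁ σ-max }
      ; closed = λ { (here refl) σ≼ρ ρ≼σ → here (≼-antisym ρ≼σ σ≼ρ) }
      ; branching = λ { _ (here refl) σ-not-max →
          contradiction (here refl , λ { _ (here refl) → ≺-irrefl }) σ-not-max }
      ; maximal = λ { _ (here refl , _) → σ-max }
      ; monochromatic = λ { _ (here refl , _) → refl }
      }
    }

  Child : Seq → Set
  Child σ = ∃[ x ] MonoSubtree (σ ++ [ x ])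

  module Graft {σ : Seq} (σ∈T : σ ∈ T) (c : Fin k) (ws : List (Child σ))
               (labels-unique : Unique (map proj₁ ws)) (length≡1+n : length ws ≡ suc n)
               (ws-colour : All (λ w → colour (proj₂ w) ≡ c) ws) where

    subtree : Child σ → FinSet
    subtree w = nodes (proj₂ w)

    S : FinSet
    S = σ ∷ concatMap subtree ws

    ∈S⁺ : ∀ {w} → w ∈ ws → τ ∈ subtree w → τ ∈ S
    ∈S⁺ w∈ws τ∈w = there (∈-concatMap⁺ subtree (lose w∈ws τ∈w))

    ∈-subtrees⁻ : τ ∈ concatMap subtree ws → ∃[ w ] (w ∈ ws × τ ∈ subtree w)
    ∈-subtrees⁻ τ∈ = find (∈-concatMap⁻ subtree τ∈)

    ∈S⇒∈subtree : ∀ {w} → w ∈ ws → τ ∈ S → (σ ++ [ proj₁ w ]) ≼ τ → τ ∈ subtree w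
    ∈S⇒∈subtree _ (here refl) σx≼σ = contradiction σx≼σ ∷ʳ-⋠
    ∈S⇒∈subtree w∈ws (there τ∈) σx≼τ with ∈-subtrees⁻ τ∈
    ... | w′ , w′∈ws , τ∈w′
      with refl ← Unique-map-injective labels-unique w′∈ws w∈ws
                    (∷ʳ-≼-injective (above-root (proj₂ w′) τ∈w′) σx≼τ)
      = τ∈w′

    maximal⁺ : ∀ {w} → w ∈ ws → Maximal (subtree w) τ → Maximal S τ
    maximal⁺ {w = w} w∈ws (τ∈w , τ-max) = ∈S⁺ w∈ws τ∈w , λ ρ ρ∈S τ≺ρ →
      τ-max ρ (∈S⇒∈subtree w∈ws ρ∈S (≼-trans (above-root (proj₂ w) τ∈w) (≺⇒≼ τ≺ρ))) τ≺ρ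

    maximal⁻ : ∀ {w} → w ∈ ws → τ ∈ subtree w → Maximal S τ → Maximal (subtree w) τ
    maximal⁻ w∈ws τ∈w (_ , τ-max) = τ∈w , λ ρ ρ∈w → τ-max ρ (∈S⁺ w∈ws ρ∈w)

    σ-not-maximal : ¬ Maximal S σ
    σ-not-maximal (_ , σ-max) =
      let (x , t) , w∈ws = length≡suc⇒∃∈ ws length≡1+n
      in σ-max (σ ++ [ x ]) (∈S⁺ w∈ws (root∈ t)) ([ x ] , (λ ()) , refl)

    above-rootS : τ ∈ S → σ ≼ τ
    above-rootS (here refl) = ≼-refl
    above-rootS (there τ∈) =
      let (x , t) , _ , τ∈w = ∈-subtrees⁻ τ∈ in ≼-trans ([ x ] , refl) (above-root t τ∈w)

    S⊆T : S ⊆ₛ T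
    S⊆T _ (here refl) = σ∈T
    S⊆T τ (there τ∈) = let w , _ , τ∈w = ∈-subtrees⁻ τ∈ in ⊆T (proj₂ w) τ τ∈w

    closedS : ∀ {τ ρ} → τ ∈ S → σ ≼ ρ → ρ ≼ τ → ρ ∈ S
    closedS (here refl) σ≼ρ ρ≼σ = here (≼-antisym ρ≼σ σ≼ρ)
    closedS {ρ = ρ} (there τ∈) σ≼ρ ρ≼τ with ∈-subtrees⁻ τ∈ | m≤n⇒m<n∨m≡n (≼-length σ≼ρ)
    ... | _ | inj₂ σ≡ρ = here (sym (≼∧length≡⇒≡ σ≼ρ σ≡ρ))
    ... | (x , t) , w∈ws , τ∈w | inj₁ σ<ρ = ∈S⁺ w∈ws (closed t τ∈w σx≼ρ ρ≼τ)
      where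
      σx≼ρ : (σ ++ [ x ]) ≼ ρ
      σx≼ρ = ≼-by-length (above-root t τ∈w) ρ≼τ (subst (_≤ length ρ) (sym (length-∷ʳ σ)) σ<ρ)

    branchingS : Branching (suc n) S
    branchingS _ (here refl) _ = map proj₁ ws , labels-unique ,
      trans (length-map proj₁ ws) length≡1+n , λ x → mk⇔ (child⇒label x) (label⇒child x)
      where
      child⇒label : ∀ x → (σ ++ [ x ]) ∈ S → x ∈ map proj₁ ws
      child⇒label x (here σx≡σ) = contradiction ([] , trans (++-identityʳ _) σx≡σ) ∷ʳ-⋠
      child⇒label x (there σx∈) with ∈-subtrees⁻ σx∈
      ... | w , w∈ws , σx∈w with refl ← ∷ʳ-≼-injective (above-root (proj₂ w) σx∈w) ≼-refl =
        ∈-map⁺ proj₁ w∈ws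

      label⇒child : ∀ x → x ∈ map proj₁ ws → (σ ++ [ x ]) ∈ S
      label⇒child x x∈ with ∈-map⁻ proj₁ x∈
      ... | w , w∈ws , refl = ∈S⁺ w∈ws (root∈ (proj₂ w))
    branchingS τ (there τ∈) τ-not-max with ∈-subtrees⁻ τ∈
    ... | w , w∈ws , τ∈w with branching (proj₂ w) τ τ∈w (τ-not-max ∘ maximal⁺ w∈ws)
    ... | xs , xs-unique , length≡ , succ⇔ = xs , xs-unique , length≡ , λ x → mk⇔
      (λ τx∈S → Equivalence.to (succ⇔ x)
                  (∈S⇒∈subtree w∈ws τx∈S (≼-trans (above-root (proj₂ w) τ∈w) ([ x ] , refl))))
      (λ x∈xs → ∈S⁺ w∈ws (Equivalence.from (succ⇔ x) x∈xs))

    maximalS : MaxSub S T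
    maximalS _ τ-max@(here refl , _) = contradiction τ-max σ-not-maximal
    maximalS τ τ-max@(there τ∈ , _) =
      let w , w∈ws , τ∈w = ∈-subtrees⁻ τ∈ in maximal (proj₂ w) τ (maximal⁻ w∈ws τ∈w τ-max)

    monochromaticS : ∀ τ → Maximal S τ → χ τ ≡ c
    monochromaticS _ τ-max@(here refl , _) = contradiction τ-max σ-not-maximal
    monochromaticS τ τ-max@(there τ∈ , _) =
      let w , w∈ws , τ∈w = ∈-subtrees⁻ τ∈
      in trans (monochromatic (proj₂ w) τ (maximal⁻ w∈ws τ∈w τ-max)) (All.lookup ws-colour w∈ws)

    graft : MonoSubtree σ
    graft = record
      { colour = c
      ; nodes = S
      ; isMonoSubtree = record
        { root∈ = here refl
        ; above-root = above-rootS
        ; ⊆T = S⊆T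
        ; closed = closedS
        ; branching = branchingS
        ; maximal = maximalS
        ; monochromatic = monochromaticS
        }
      }

  module _ {m : ℕ} (T-branching : Branching m T) (k*n<m : k * n < m) where

    graft-majority : σ ∈ T → (ws : List (Child σ)) → Unique (map proj₁ ws) → length ws ≡ m →
                     MonoSubtree σ
    graft-majority {σ} σ∈T ws labels-unique length≡m =
      Graft.graft σ∈T c chosen chosen-unique chosen-length chosen-colour
      where
      colour-of : Child σ → Fin k
      colour-of w = colour (proj₂ w)

      majority : ∃[ c ] n < length (fibre Fin._≟_ colour-of c ws)
      majority = pigeonhole Fin._≟_ colour-of n (allFin k) ws
        (All.tabulate (λ {w} _ → ∈-allFin (colour-of w)))
        (subst₂ (λ i j → i * n < j) (sym (length-tabulate {n = k} (id {A = Fin k}))) (sym length≡m)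
                k*n<m)

      c : Fin k
      c = proj₁ majority

      chosen : List (Child σ)
      chosen = take (suc n) (fibre Fin._≟_ colour-of c ws)

      chosen-unique : Unique (map proj₁ chosen)
      chosen-unique =
        AllPairs.map⁺ (AllPairs.take⁺ (suc n) (AllPairs.filter⁺ _ (AllPairs.map⁻ labels-unique)))

      chosen-length : length chosen ≡ suc n
      chosen-length =
        trans (length-take (suc n) (fibre Fin._≟_ colour-of c ws)) (m≤n⇒m⊓n≡m (proj₂ majority))

      chosen-colour : All (λ w → colour-of w ≡ c) chosen
      chosen-colour = All.take⁺ (suc n) (All.all-filter _ ws)

    build : ∀ d → σ ∈ T → height T ≤ length σ + d → MonoSubtree σ
    build {σ} zero σ∈T height≤σ = leaf (σ∈T , λ τ τ∈T σ≺τ →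
      <⇒≱ (≺-length σ≺τ)
          (≤-trans (length≤height τ∈T) (subst (height T ≤_) (+-identityʳ _) height≤σ)))
    build {σ} (suc d) σ∈T height≤σ+1+d with any? (σ ≺?_) T
    ... | no σ-max = leaf (σ∈T , λ τ τ∈T σ≺τ → σ-max (lose τ∈T σ≺τ))
    ... | yes σ≺T
      with T-branching σ σ∈T (λ (_ , σ-max) → let τ , τ∈T , σ≺τ = find σ≺T in σ-max τ τ∈T σ≺τ)
    ... | xs , xs-unique , length≡m , succ⇔ =
      graft-majority σ∈T children (subst Unique (sym labels) xs-unique)
        (trans (sym (length-map proj₁ children)) (trans (cong length labels) length≡m))
      where
      height≤σx+d : ∀ x → height T ≤ length (σ ++ [ x ]) + d
      height≤σx+d x =
        subst (height T ≤_) (trans (+-suc (length σ) d) (cong (_+ d) (sym (length-∷ʳ σ))))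
              height≤σ+1+d

      children : List (Child σ)
      children = mapWith∈ xs λ {x} x∈xs →
        x , build d (Equivalence.from (succ⇔ x) x∈xs) (height≤σx+d x)

      labels : map proj₁ children ≡ xs
      labels = map-proj₁-mapWith∈ xs _

P-holds : ∀ {m k} n → k * n < m → P m k (suc n) 1
P-holds n k*n<m T ((σ , σ∈T) , T-closed) T-branching χ =
  nodes t , (([] , root∈ t) , λ τ ρ τ∈t ρ≼τ → closed t τ∈t (ρ , refl) ρ≼τ) ,
  ⊆T t , branching t , maximal t ,
  [ colour t ] , s≤s z≤n , λ τ τ-max → here (monochromatic t τ τ-max)
  where
  open MonoSubtrees T n χ
  open MonoSubtree

  t : MonoSubtree []
  t = build T-branching k*n<m (height T) (T-closed σ [] σ∈T (σ , refl)) ≤-refl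

%-/-injective : ∀ {a b k} .{{_ : NonZero k}} → a % k ≡ b % k → a / k ≡ b / k → a ≡ b
%-/-injective {a} {b} {k} a%k≡b%k a/k≡b/k = begin
  a                 ≡⟨ m≡m%n+[m/n]*n a k ⟩
  a % k + a / k * k ≡⟨ cong₂ (λ r q → r + q * k) a%k≡b%k a/k≡b/k ⟩
  b % k + b / k * k ≡⟨ sym (m≡m%n+[m/n]*n b k) ⟩
  b                 ∎
  where open ≡-Reasoning

residue-class-bound : ∀ {k n r} {xs : List ℕ} .{{_ : NonZero k}} → Unique xs →
  All (_< k * n) xs → All (λ x → x % k ≡ r) xs → length xs ≤ n
residue-class-bound {k} {n} {r} {xs} xs-unique xs<k*n xs%k≡r = ≮⇒≥ λ n<|xs| →
  let q , 1<|fibre| = pigeonhole _≟_ (_/ k) 1 (upTo n) xs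
        (All.map (λ {x} x<k*n → ∈-upTo⁺ (m<n*o⇒m/o<n (subst (x <_) (*-comm k n) x<k*n))) xs<k*n)
        (subst₂ _<_ (sym (trans (*-identityʳ _) (length-upTo n))) refl n<|xs|)
  in collision (fibre _≟_ (_/ k) q xs) 1<|fibre| (Unique.filter⁺ _ xs-unique)
       (All.all-filter _ xs) (All.filter⁺ _ xs%k≡r)
  where
  collision : ∀ {q} ys → 1 < length ys → Unique ys →
              All (λ y → y / k ≡ q) ys → All (λ y → y % k ≡ r) ys → ⊥
  collision (a ∷ b ∷ _) _ ((a≢b ∷ _) ∷ _) (a/k≡q ∷ b/k≡q ∷ _) (a%k≡r ∷ b%k≡r ∷ _) =
    a≢b (%-/-injective (trans a%k≡r (sym b%k≡r)) (trans a/k≡q (sym b/k≡q)))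
  collision (_ ∷ []) (s≤s ()) _ _ _

fan : ℕ → FinSet
fan m = [] ∷ map [_] (upTo m)

fan-depth : ∀ {m} → τ ∈ fan m → length τ ≤ 1
fan-depth (here refl) = z≤n
fan-depth (there τ∈) with ∈-map⁻ [_] τ∈
... | _ , _ , refl = ≤-refl

[x]∈fan⇒x<m : ∀ {m} → [ x ] ∈ fan m → x < m
[x]∈fan⇒x<m (there x∈) with ∈-map⁻ [_] x∈
... | _ , x∈upTo , refl = ∈-upTo⁻ x∈upTo

singleton-maximal : ∀ {m A} → A ⊆ₛ fan m → [ x ] ∈ A → Maximal A [ x ]
singleton-maximal A⊆fan x∈A = x∈A , λ τ τ∈A x≺τ → <⇒≱ (≺-length x≺τ) (fan-depth (A⊆fan τ τ∈A))

fan-isTree : ∀ m → IsTree (fan m)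
fan-isTree m = ([] , here refl) , λ σ τ → closed
  where
  closed : σ ∈ fan m → τ ≼ σ → τ ∈ fan m
  closed {τ = []} _ _ = here refl
  closed {τ = _ ∷ _} (here refl) (_ , ())
  closed {τ = _ ∷ _} (there σ∈) τ≼σ with ∈-map⁻ [_] σ∈
  ... | _ , x∈upTo , refl with refl ← ≼∧length≡⇒≡ τ≼σ (≤-antisym (≼-length τ≼σ) (s≤s z≤n)) =
    there (∈-map⁺ [_] x∈upTo)

fan-branching : ∀ m → Branching m (fan m)
fan-branching m [] _ _ = upTo m , Unique.upTo⁺ m , length-upTo m , λ x →
  mk⇔ (∈-upTo⁺ ∘ [x]∈fan⇒x<m) (λ x∈upTo → there (∈-map⁺ [_] x∈upTo))
fan-branching m (_ ∷ _) (here ()) _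
fan-branching m (_ ∷ _) (there σ∈) σ-not-max with ∈-map⁻ [_] σ∈
... | _ , _ , refl = contradiction (singleton-maximal (λ _ → id) (there σ∈)) σ-not-max

fan-subtree-root : ∀ {m i T′} → 0 < m → IsTree T′ → T′ ⊆ₛ fan m → MaxSub T′ (fan m) →
                   Branching i T′ → ExactlySucc i T′ []
fan-subtree-root 0<m ((τ , τ∈T′) , T′-closed) _ T′-maximal T′-branching =
  T′-branching [] (T′-closed τ [] τ∈T′ (τ , refl)) λ []-max →
    proj₂ (T′-maximal [] []-max) [ 0 ] (there (∈-map⁺ [_] (∈-upTo⁺ 0<m))) ([ 0 ] , (λ ()) , refl)

residue-colouring : ∀ k .{{_ : NonZero k}} → Seq → Fin k
residue-colouring k [] = 0 mod k
residue-colouring k (x ∷ _) = x mod k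

P-fails : ∀ {m k} n .{{_ : NonZero k}} → 0 < m → m ≤ k * n → ¬ P m k (suc n) 1
P-fails {m} {k} n 0<m m≤k*n P[m,k,1+n,1]
  with P[m,k,1+n,1] (fan m) (fan-isTree m) (fan-branching m) (residue-colouring k)
... | T′ , T′-tree , T′⊆fan , T′-branching , T′-maximal , cs , |cs|≤1 , leaf-colour∈cs
  with fan-subtree-root 0<m T′-tree T′⊆fan T′-maximal T′-branching
... | xs , xs-unique , |xs|≡1+n , [x]∈T′⇔x∈xs =
  <-irrefl refl (subst (_≤ n) |xs|≡1+n (residue-class-bound xs-unique xs<k*n xs%k≡c))
  where
  leaf-colour : ∃[ c ] (∀ {b} → b ∈ cs → b ≡ c)
  leaf-colour = at-most-one-value cs |cs|≤1 (0 mod k)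

  c : Fin k
  c = proj₁ leaf-colour

  [x]∈T′ : x ∈ xs → [ x ] ∈ T′
  [x]∈T′ {x} x∈xs = Equivalence.from ([x]∈T′⇔x∈xs x) x∈xs

  xs<k*n : All (_< k * n) xs
  xs<k*n = All.tabulate λ {x} x∈xs → <-≤-trans ([x]∈fan⇒x<m (T′⊆fan [ x ] ([x]∈T′ x∈xs))) m≤k*n

  xs%k≡c : All (λ x → x % k ≡ toℕ c) xs
  xs%k≡c = All.tabulate λ {x} x∈xs → trans (sym (toℕ-fromℕ< (m%n<n x k))) (cong toℕ
    (proj₂ leaf-colour (leaf-colour∈cs [ x ] (singleton-maximal T′⊆fan ([x]∈T′ x∈xs)))))

lemma4p6 : ∀ (m k n : ℕ) → 0 < m → 0 < k → 0 < n →
    ((¬ P m k n 1) ⇔ (m < (k * n ∸ k) + 1))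
lemma4p6 m k zero _ _ ()
lemma4p6 m k (suc n) 0<m 0<k _ = mk⇔
  (λ ¬P → subst (m <_) (sym threshold) (s≤s (≮⇒≥ (¬P ∘ P-holds n))))
  (λ m<threshold → P-fails n {{>-nonZero 0<k}} 0<m (m<1+n⇒m≤n (subst (m <_) threshold m<threshold)))
  where
  open ≡-Reasoning
  threshold : k * suc n ∸ k + 1 ≡ suc (k * n)
  threshold = begin
    k * suc n ∸ k + 1 ≡⟨ cong (λ i → i ∸ k + 1) (*-suc k n) ⟩
    k + k * n ∸ k + 1 ≡⟨ cong (_+ 1) (m+n∸m≡n k (k * n)) ⟩
    k * n + 1         ≡⟨ +-comm (k * n) 1 ⟩
    suc (k * n)       ∎
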